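{- Let $n\ge 1$. (1) For nonnegative integers $i,j$, the number of plane trees with $n$ edges, $i$ old leaves and $j$ young leaves is $$\frac{1}{n}\binom{n}{i}\binom{n-i}{j}\binom{n-i-j}{i-1}.$$ (2) For a positive integer $k$, the number of plane trees with $n$ edges and $k$ old leaves is $$\frac{2^{n-2k+1}}{k}\binom{n-1}{2k-2}\binom{2k-2}{k-1}.$$ (3) For a nonnegative integer $k$, the number of plane trees with $n$ edges and $k$ young leaves is $$\binom{n-1}{k}M_{n-k-1}.$$
   Context: A plane (ordered) tree is a rooted tree in which the children of each vertex are linearly ordered (from left to right). A leaf is a vertex with no children; the tree with a single vertex has no leaves. A leaf is an old leaf if it is the leftmost child of its parent, and a young leaf otherwise. Binomial coefficients $\binom{a}{b}$ are taken to be $0$ when $b<0$ or $b>a$. $M_m=\sum_{k=0}^{\lfloor m/2\rfloor}\binom{m}{2k}C_k$ is the $m$-th Motzkin number (the number of Motzkin paths of length $m$, i.e. lattice paths from $(0,0)$ to $(m,0)$ with steps $(1,1),(1,-1),(1,0)$ never going below the $x$-axis), where $C_k=\frac{1}{k+1}\binom{2k}{k}$ is the $k$-th Catalan number; $M_m=0$ for $m<0$. -}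

module Defs where

open import Data.Nat using (ℕ; zero; suc; _+_; _*_; _∸_; _/_)
open import Data.Nat.Combinatorics using (_C_)
open import Data.Integer using (ℤ; +_; -[1+_])
open import Data.List using (List; []; _∷_; length)
open import Data.List.Relation.Unary.Unique.Propositional using (Unique)
open import Data.List.Membership.Propositional using (_∈_)
open import Data.Product using (Σ; _×_)
open import Function.Bundles using (_⇔_)
open import Relation.Binary.PropositionalEquality using (_≡_)

data Tree : Set where
  node : List Tree → Tree

isLeaf : Tree → ℕ
isLeaf (node [])      = 1
isLeaf (node (_ ∷ _)) = 0

mutual
  edges : Tree → ℕ
  edges (node ts) = edgesL ts

  edgesL : List Tree → ℕ
  edgesL []       = 0
  edgesL (t ∷ ts) = suc (edges t + edgesL ts)

mutual
  -- old leaves: leaves that are the leftmost child of their parent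
  oldLeaves : Tree → ℕ
  oldLeaves (node [])       = 0
  oldLeaves (node (t ∷ ts)) = isLeaf t + oldLeaves t + oldLeavesL ts

  -- old leaves inside the subtrees of a list (the list roots themselves
  -- are NOT leftmost children here, so they are not counted)
  oldLeavesL : List Tree → ℕ
  oldLeavesL []       = 0
  oldLeavesL (t ∷ ts) = oldLeaves t + oldLeavesL ts

mutual
  -- young leaves: leaves that are not the leftmost child of their parent
  youngLeaves : Tree → ℕ
  youngLeaves (node [])       = 0
  youngLeaves (node (t ∷ ts)) = youngLeaves t + youngLeavesL ts

  youngLeavesL : List Tree → ℕ
  youngLeavesL []       = 0
  youngLeavesL (t ∷ ts) = isLeaf t + youngLeaves t + youngLeavesL ts

NumberOf : (Tree → Set) → ℕ → Set
NumberOf P c = Σ (List Tree) λ L → Unique L × ((t : Tree) → (t ∈ L) ⇔ P t) × length L ≡ c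

-- Binomial coefficient with integer arguments, 0 when b < 0 or b > a
-- (in particular 0 when a < 0).
binom : ℤ → ℤ → ℕ
binom (+ a)     (+ b)     = a C b
binom (+ a)     -[1+ _ ]  = 0
binom -[1+ _ ]  _         = 0

catalan : ℕ → ℕ
catalan k = ((2 * k) C k) / suc k

sumUpTo : ℕ → (ℕ → ℕ) → ℕ
sumUpTo zero    f = f 0
sumUpTo (suc n) f = sumUpTo n f + f (suc n)

-- Motzkin numbers: M_m = Σ_{k=0}^{⌊m/2⌋} C(m,2k) C_k   (terms with 2k > m vanish)
motzkin : ℕ → ℕ
motzkin m = sumUpTo m (λ k → (m C (2 * k)) * catalan k)

motzkinℤ : ℤ → ℕ
motzkinℤ (+ m)     = motzkin m
motzkinℤ -[1+ _ ]  = 0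

-- Look at the first root of a forest of non-leaf plane trees: either the first tree is a single
-- edge, or the root has a single child and it is not a leaf, or the second child of the root is a
-- leaf, or it is not. Removing that edge, contracting the root edge, deleting the leaf, or cutting
-- the second child off as a tree of its own (undoing plant, raise, sprout or graft)
-- leaves a forest with one edge less. Recording the number k of trees, the numbers k + t of old
-- and j of young leaves and the number t + s of internal non-root vertices, this gives a
-- recurrence solved by (k / n) n! / ((k + t)! j! t! s!), where n = k + 2t + j + s is the number
-- of edges. For one tree this is (1); summing C(n - 1 - 2t, j) over j gives the power of 2 in (2),
-- and summing C(n - 1 - j, 2t) Catalan(t) over t gives the Motzkin number in (3).

module Submission where

open import Defs
open import Data.Nat
open import Data.Nat.Properties
open import Data.Nat.Combinatorics using (_C_; nCk+nC[k+1]≡[n+1]C[k+1]; k![n∸k]!∣n!)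
open import Data.Nat.Combinatorics.Specification using (nCk≡n!/k![n-k]!; k>n⇒nCk≡0)
open import Data.Nat.DivMod using (m/n*n≡m)
open import Data.Nat.Divisibility using (divides)
open import Data.Nat.Tactic.RingSolver using (solve-∀)
open import Data.List using (List; []; _∷_; [_]; length; map; _++_)
open import Data.Nat.ListAction using (sum)
open import Data.List.Properties using (length-map; length-++; map-∘; map-id-local)
open import Data.List.Relation.Unary.All as All using (All; []; _∷_)
import Data.List.Relation.Unary.All.Properties as All
open import Data.List.Relation.Unary.Any using (here)
open import Data.List.Relation.Unary.Unique.Propositional using (Unique; []; _∷_)
import Data.List.Relation.Unary.Unique.Propositional.Properties as Unique
open import Data.List.Relation.Binary.Disjoint.Propositional using (Disjoint)
open import Data.List.Membership.Propositional using (_∈_; _∉_)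
open import Data.List.Membership.Propositional.Properties using (∈-map⁺; ∈-map⁻; ∈-++⁺ˡ; ∈-++⁺ʳ; ∈-++⁻)
open import Data.Empty using (⊥; ⊥-elim)
open import Data.Unit using (⊤; tt)
open import Function.Bundles using (_⇔_; mk⇔; Equivalence)
import Function.Properties.Equivalence as ⇔
open import Function.Consequences.Propositional using (inverseʳ⇒injective; strictlyInverseʳ⇒inverseʳ)
open import Data.Product using (Σ; ∃₂; _×_; _,_; proj₁; proj₂)
open import Data.Sum using (inj₁; inj₂)
open import Relation.Binary.PropositionalEquality using (_≡_; refl; sym; trans; cong; cong₂; subst; subst₂; module ≡-Reasoning)
open import Algebra.Properties.CommutativeSemigroup *-commutativeSemigroup using (x∙yz≈y∙xz)
open ≡-Reasoning

factorials : ℕ → ℕ → ℕ → ℕ → ℕ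
factorials a b c d = a ! * (b ! * (c ! * d !))

factorials≢0 : ∀ a b c d → NonZero (factorials a b c d)
factorials≢0 a b c d =
  m*n≢0 (a !) _ {{a !≢0}} {{m*n≢0 (b !) _ {{b !≢0}} {{c !* d !≢0}}}}

C-factorial : ∀ a b → ((a + b) C a) * (a ! * b !) ≡ (a + b) !
C-factorial a b = begin
  ((a + b) C a) * (a ! * b !)              ≡⟨ cong (λ m → ((a + b) C a) * (a ! * m !)) (sym (m+n∸m≡n a b)) ⟩
  ((a + b) C a) * (a ! * (a + b ∸ a) !)    ≡⟨ cong (_* (a ! * (a + b ∸ a) !)) (nCk≡n!/k![n-k]! a≤a+b) ⟩
  ((a + b) ! / (a ! * (a + b ∸ a) !)) {{a !* (a + b ∸ a) !≢0}} * (a ! * (a + b ∸ a) !)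
                                         ≡⟨ m/n*n≡m {{a !* (a + b ∸ a) !≢0}} (k![n∸k]!∣n! a≤a+b) ⟩
  (a + b) !                              ∎
  where a≤a+b = m≤m+n a b

C*∸-vanishes : ∀ {x a b} (g : ℕ → ℕ) → (∀ {y} → y < b → g y ≡ 0) → x < a + b → (x C a) * g (x ∸ a) ≡ 0
C*∸-vanishes {x} {a} {b} g g-vanishes x<a+b with ≤-<-connex a x
... | inj₁ a≤x = trans (cong ((x C a) *_) (g-vanishes x∸a<b)) (*-zeroʳ (x C a))
  where x∸a<b = subst (x ∸ a <_) (m+n∸m≡n a b) (∸-monoˡ-< x<a+b a≤x)
... | inj₂ x<a = cong (_* g (x ∸ a)) (k>n⇒nCk≡0 x<a)

C*-cong : ∀ {x a y z} → (a ≤ x → y ≡ z) → (x C a) * y ≡ (x C a) * z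
C*-cong {x} {a} {y} {z} y≡z with ≤-<-connex a x
... | inj₁ a≤x = cong ((x C a) *_) (y≡z a≤x)
... | inj₂ x<a rewrite k>n⇒nCk≡0 x<a = refl

choose₃ : ℕ → ℕ → ℕ → ℕ → ℕ
choose₃ x a b c = (x C a) * (((x ∸ a) C b) * ((x ∸ a ∸ b) C c))

choose₃-factorial : ∀ {x} a b c d → x ≡ a + (b + (c + d)) → choose₃ x a b c * factorials a b c d ≡ x !
choose₃-factorial a b c d refl = begin
  choose₃ x a b c * factorials a b c d
    ≡⟨ cong₂ (λ u v → ((x C a) * ((u C b) * (v C c))) * factorials a b c d) (m+n∸m≡n a _) x∸a∸b ⟩
  ((x C a) * (((b + (c + d)) C b) * ((c + d) C c))) * factorials a b c d
    ≡⟨ regroup (x C a) ((b + (c + d)) C b) ((c + d) C c) (a !) (b !) (c !) (d !) ⟩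
  (x C a) * (a ! * (((b + (c + d)) C b) * (b ! * (((c + d) C c) * (c ! * d !)))))
    ≡⟨ cong (λ u → (x C a) * (a ! * (((b + (c + d)) C b) * (b ! * u)))) (C-factorial c d) ⟩
  (x C a) * (a ! * (((b + (c + d)) C b) * (b ! * (c + d) !)))
    ≡⟨ cong (λ u → (x C a) * (a ! * u)) (C-factorial b (c + d)) ⟩
  (x C a) * (a ! * (b + (c + d)) !)
    ≡⟨ C-factorial a (b + (c + d)) ⟩
  x ! ∎
  where
  x = a + (b + (c + d))
  x∸a∸b : x ∸ a ∸ b ≡ c + d
  x∸a∸b = trans (cong (_∸ b) (m+n∸m≡n a _)) (m+n∸m≡n b (c + d))
  regroup : ∀ X Y Z A B C D → (X * (Y * Z)) * (A * (B * (C * D))) ≡ X * (A * (Y * (B * (Z * (C * D)))))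
  regroup = solve-∀

choose₃-vanishes : ∀ {x} a b c → x < a + (b + c) → choose₃ x a b c ≡ 0
choose₃-vanishes {x} a b c =
  C*∸-vanishes {x} {a} (λ y → (y C b) * ((y ∸ b) C c)) (λ {y} → C*∸-vanishes {y} {b} (_C c) k>n⇒nCk≡0)

2*n≡n+n : ∀ n → 2 * n ≡ n + n
2*n≡n+n n = cong (λ x → n + x) (+-identityʳ n)

[1+t]*2tC[1+t]≡t*2tCt : ∀ t → suc t * ((2 * t) C suc t) ≡ t * ((2 * t) C t)
[1+t]*2tC[1+t]≡t*2tCt zero = refl
[1+t]*2tC[1+t]≡t*2tCt t@(suc u) = *-cancelʳ-≡ _ _ (suc u ! * u !) {{suc u !* u !≢0}} (begin
  (suc t * X) * (suc u ! * u !) ≡⟨ regroupˡ (suc t) X (suc u !) (u !) ⟩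
  X * (suc t ! * u !)           ≡⟨ cong (λ x → (x C suc t) * (suc t ! * u !)) 2t≡[t+1]+u ⟩
  ((suc t + u) C suc t) * (suc t ! * u !) ≡⟨ C-factorial (suc t) u ⟩
  (suc t + u) !                 ≡⟨ cong _! (sym 2t≡[t+1]+u) ⟩
  (2 * t) !                     ≡⟨ cong _! (2*n≡n+n t) ⟩
  (t + t) !                     ≡⟨ sym (C-factorial t t) ⟩
  ((t + t) C t) * (t ! * t !)   ≡⟨ cong (λ x → (x C t) * (t ! * t !)) (sym (2*n≡n+n t)) ⟩
  Y * (t ! * t !)               ≡⟨ regroupʳ t Y (t !) (u !) ⟩
  (t * Y) * (t ! * u !)         ∎)
  where
  X = (2 * t) C suc t
  Y = (2 * t) C t
  2t≡[t+1]+u : 2 * t ≡ suc t + u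
  2t≡[t+1]+u = trans (2*n≡n+n t) (cong suc (+-suc u u))
  regroupˡ : ∀ a x A B → (a * x) * (A * B) ≡ x * ((a * A) * B)
  regroupˡ = solve-∀
  regroupʳ : ∀ a y A B → y * (A * (a * B)) ≡ (a * y) * (A * B)
  regroupʳ = solve-∀

catalan*suc : ∀ t → catalan t * suc t ≡ (2 * t) C t
catalan*suc t = m/n*n≡m (divides (x ∸ y) x≡[x∸y]*[1+t])
  where
  x = (2 * t) C t
  y = (2 * t) C suc t
  x≡[x∸y]*[1+t] : x ≡ (x ∸ y) * suc t
  x≡[x∸y]*[1+t] = sym (begin
    (x ∸ y) * suc t        ≡⟨ *-comm (x ∸ y) (suc t) ⟩
    suc t * (x ∸ y)        ≡⟨ *-distribˡ-∸ (suc t) x y ⟩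
    suc t * x ∸ suc t * y  ≡⟨ cong (suc t * x ∸_) ([1+t]*2tC[1+t]≡t*2tCt t) ⟩
    x + t * x ∸ t * x      ≡⟨ m+n∸n≡m x (t * x) ⟩
    x                      ∎)

catalan-factorial : ∀ t → catalan t * (suc t ! * t !) ≡ (2 * t) !
catalan-factorial t = begin
  catalan t * ((suc t * t !) * t !)  ≡⟨ regroup (catalan t) (suc t) (t !) ⟩
  (catalan t * suc t) * (t ! * t !)  ≡⟨ cong (_* (t ! * t !)) (catalan*suc t) ⟩
  ((2 * t) C t) * (t ! * t !)        ≡⟨ cong (λ x → (x C t) * (t ! * t !)) (2*n≡n+n t) ⟩
  ((t + t) C t) * (t ! * t !)        ≡⟨ C-factorial t t ⟩
  (t + t) !                          ≡⟨ cong _! (sym (2*n≡n+n t)) ⟩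
  (2 * t) !                          ∎
  where
  regroup : ∀ c a f → c * ((a * f) * f) ≡ (c * a) * (f * f)
  regroup = solve-∀

C*C*C-factorial : ∀ {x} a b c d → x ≡ (a + b) + (c + d) →
  ((x C (a + b)) * ((a + b) C a) * ((x ∸ (a + b)) C c)) * (a ! * (c ! * (b ! * d !))) ≡ x !
C*C*C-factorial a b c d refl = begin
  ((x C (a + b)) * ((a + b) C a) * ((x ∸ (a + b)) C c)) * (a ! * (c ! * (b ! * d !)))
    ≡⟨ cong (λ y → ((x C (a + b)) * ((a + b) C a) * (y C c)) * (a ! * (c ! * (b ! * d !)))) (m+n∸m≡n (a + b) (c + d)) ⟩
  ((x C (a + b)) * ((a + b) C a) * ((c + d) C c)) * (a ! * (c ! * (b ! * d !)))
    ≡⟨ regroup (x C (a + b)) ((a + b) C a) ((c + d) C c) (a !) (b !) (c !) (d !) ⟩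
  (x C (a + b)) * ((((a + b) C a) * (a ! * b !)) * (((c + d) C c) * (c ! * d !)))
    ≡⟨ cong₂ (λ u v → (x C (a + b)) * (u * v)) (C-factorial a b) (C-factorial c d) ⟩
  (x C (a + b)) * ((a + b) ! * (c + d) !)
    ≡⟨ C-factorial (a + b) (c + d) ⟩
  x ! ∎
  where
  x = (a + b) + (c + d)
  regroup : ∀ X Y Z A B C D → (X * Y * Z) * (A * (C * (B * D))) ≡ X * ((Y * (A * B)) * (Z * (C * D)))
  regroup = solve-∀

C*C*catalan-factorial : ∀ {x} j t s → x ≡ j + (2 * t + s) →
  ((x C j) * (((x ∸ j) C (2 * t)) * catalan t)) * factorials (suc t) j t s ≡ x !
C*C*catalan-factorial j t s refl = begin
  ((x C j) * (((x ∸ j) C (2 * t)) * catalan t)) * factorials (suc t) j t s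
    ≡⟨ cong (λ y → ((x C j) * ((y C (2 * t)) * catalan t)) * factorials (suc t) j t s) (m+n∸m≡n j (2 * t + s)) ⟩
  ((x C j) * (((2 * t + s) C (2 * t)) * catalan t)) * (suc t ! * (j ! * (t ! * s !)))
    ≡⟨ regroup (x C j) ((2 * t + s) C (2 * t)) (catalan t) (suc t !) (j !) (t !) (s !) ⟩
  (x C j) * (j ! * (((2 * t + s) C (2 * t)) * ((catalan t * (suc t ! * t !)) * s !)))
    ≡⟨ cong (λ u → (x C j) * (j ! * (((2 * t + s) C (2 * t)) * (u * s !)))) (catalan-factorial t) ⟩
  (x C j) * (j ! * (((2 * t + s) C (2 * t)) * ((2 * t) ! * s !)))
    ≡⟨ cong (λ u → (x C j) * (j ! * u)) (C-factorial (2 * t) s) ⟩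
  (x C j) * (j ! * (2 * t + s) !)
    ≡⟨ C-factorial j (2 * t + s) ⟩
  x ! ∎
  where
  x = j + (2 * t + s)
  regroup : ∀ X Y K A J T S → (X * (Y * K)) * (A * (J * (T * S))) ≡ X * (J * (Y * ((K * (A * T)) * S)))
  regroup = solve-∀

sumUpTo-cong : ∀ m {f g : ℕ → ℕ} → (∀ i → f i ≡ g i) → sumUpTo m f ≡ sumUpTo m g
sumUpTo-cong zero    f≡g = f≡g 0
sumUpTo-cong (suc m) f≡g = cong₂ _+_ (sumUpTo-cong m f≡g) (f≡g (suc m))

*-distribˡ-sumUpTo : ∀ m c f → c * sumUpTo m f ≡ sumUpTo m (λ i → c * f i)
*-distribˡ-sumUpTo zero    c f = refl
*-distribˡ-sumUpTo (suc m) c f =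
  trans (*-distribˡ-+ c (sumUpTo m f) (f (suc m))) (cong (_+ c * f (suc m)) (*-distribˡ-sumUpTo m c f))

sumUpTo-+ : ∀ m f g → sumUpTo m (λ i → f i + g i) ≡ sumUpTo m f + sumUpTo m g
sumUpTo-+ zero    f g = refl
sumUpTo-+ (suc m) f g =
  trans (cong (_+ (f (suc m) + g (suc m))) (sumUpTo-+ m f g))
        (+-+-comm (sumUpTo m f) (sumUpTo m g) (f (suc m)) (g (suc m)))
  where
  +-+-comm : ∀ a b c d → a + b + (c + d) ≡ a + c + (b + d)
  +-+-comm = solve-∀

sumUpTo-suc : ∀ m f → sumUpTo (suc m) f ≡ f 0 + sumUpTo m (λ i → f (suc i))
sumUpTo-suc zero    f = refl
sumUpTo-suc (suc m) f = trans (cong (_+ f (suc (suc m))) (sumUpTo-suc m f)) (+-assoc (f 0) _ _)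

sumUpTo-extend : ∀ {r} m f → r ≤ m → (∀ i → r < i → f i ≡ 0) → sumUpTo m f ≡ sumUpTo r f
sumUpTo-extend zero    f z≤n       _         = refl
sumUpTo-extend {r} (suc m) f r≤1+m f-vanishes with m≤n⇒m<n∨m≡n r≤1+m
... | inj₂ refl = refl
... | inj₁ (s≤s r≤m) = begin
  sumUpTo m f + f (suc m) ≡⟨ cong (sumUpTo m f +_) (f-vanishes (suc m) (s≤s r≤m)) ⟩
  sumUpTo m f + 0         ≡⟨ +-identityʳ _ ⟩
  sumUpTo m f             ≡⟨ sumUpTo-extend m f r≤m f-vanishes ⟩
  sumUpTo r f             ∎

sumUpTo-C : ∀ r → sumUpTo r (r C_) ≡ 2 ^ r
sumUpTo-C zero    = refl
sumUpTo-C (suc r) = begin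
  sumUpTo (suc r) (suc r C_)                          ≡⟨ sumUpTo-suc r (suc r C_) ⟩
  1 + sumUpTo r (λ j → suc r C suc j)                 ≡⟨ cong (1 +_) (sumUpTo-cong r (λ j → sym (nCk+nC[k+1]≡[n+1]C[k+1] r j))) ⟩
  1 + sumUpTo r (λ j → r C j + r C suc j)             ≡⟨ cong (1 +_) (sumUpTo-+ r (r C_) (λ j → r C suc j)) ⟩
  1 + (sumUpTo r (r C_) + sumUpTo r (λ j → r C suc j)) ≡⟨ +-comm-middle 1 (sumUpTo r (r C_)) _ ⟩
  sumUpTo r (r C_) + (1 + sumUpTo r (λ j → r C suc j)) ≡⟨ cong (sumUpTo r (r C_) +_) (sym (sumUpTo-suc r (r C_))) ⟩
  sumUpTo r (r C_) + sumUpTo (suc r) (r C_)            ≡⟨⟩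
  sumUpTo r (r C_) + (sumUpTo r (r C_) + r C suc r)    ≡⟨ cong (λ x → sumUpTo r (r C_) + (sumUpTo r (r C_) + x)) (k>n⇒nCk≡0 (n<1+n r)) ⟩
  sumUpTo r (r C_) + (sumUpTo r (r C_) + 0)            ≡⟨ cong (λ x → x + (x + 0)) (sumUpTo-C r) ⟩
  2 ^ suc r                                            ∎
  where
  +-comm-middle : ∀ a b c → a + (b + c) ≡ b + (a + c)
  +-comm-middle = solve-∀

Unique-map-inverse : ∀ {A B : Set} {f : A → B} g → (∀ F → g (f F) ≡ F) →
                     ∀ {Fs} → Unique Fs → Unique (map f Fs)
Unique-map-inverse {f = f} g g∘f≡id = Unique.map⁺ (inverseʳ⇒injective f (strictlyInverseʳ⇒inverseʳ {f⁻¹ = g} f g∘f≡id))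

All-disjoint : ∀ {A : Set} {P Q : A → Set} {xs ys} → All P xs → All Q ys →
               (∀ {x} → P x → Q x → ⊥) → Disjoint xs ys
All-disjoint Pxs Qys incompatible (x∈xs , x∈ys) = incompatible (All.lookup Pxs x∈xs) (All.lookup Qys x∈ys)

NumberOf-⇔ : ∀ {P Q c} → (∀ T → P T ⇔ Q T) → NumberOf P c → NumberOf Q c
NumberOf-⇔ P⇔Q (L , unique , ∈⇔P , len) = L , unique , (λ T → ⇔.trans (∈⇔P T) (P⇔Q T)) , len

NumberOf-byKey : ∀ {P : Tree → Set} (key : Tree → ℕ) {c : ℕ → ℕ} →
  (∀ i → NumberOf (λ T → P T × key T ≡ i) (c i)) → ∀ m → NumberOf (λ T → P T × key T ≤ m) (sumUpTo m c)
NumberOf-byKey key count zero = NumberOf-⇔ (λ T → mk⇔ (λ (p , k≡0) → p , ≤-reflexive k≡0) (λ (p , k≤0) → p , n≤0⇒n≡0 k≤0)) (count 0)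
NumberOf-byKey {P} key count (suc m) with NumberOf-byKey key count m | count (suc m)
... | L , unique , ∈⇔ , len | L′ , unique′ , ∈⇔′ , len′ =
  L ++ L′ , Unique.++⁺ unique unique′ disjoint , (λ T → mk⇔ (∈⁻ T) (∈⁺ T)) , trans (length-++ L) (cong₂ _+_ len len′)
  where
  disjoint : Disjoint L L′
  disjoint = All-disjoint (All.tabulate (λ {T} T∈ → proj₂ (Equivalence.to (∈⇔ T) T∈)))
                          (All.tabulate (λ {T} T∈ → proj₂ (Equivalence.to (∈⇔′ T) T∈)))
                          (λ k≤m k≡1+m → 1+n≰n (subst (_≤ m) k≡1+m k≤m))
  ∈⁻ : ∀ T → T ∈ L ++ L′ → P T × key T ≤ suc m
  ∈⁻ T T∈ with ∈-++⁻ L T∈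
  ... | inj₁ T∈L  = let (p , k≤m) = Equivalence.to (∈⇔ T) T∈L in p , m≤n⇒m≤1+n k≤m
  ... | inj₂ T∈L′ = let (p , k≡1+m) = Equivalence.to (∈⇔′ T) T∈L′ in p , ≤-reflexive k≡1+m
  ∈⁺ : ∀ T → P T × key T ≤ suc m → T ∈ L ++ L′
  ∈⁺ T (p , k≤1+m) with m≤n⇒m<n∨m≡n k≤1+m
  ... | inj₁ (s≤s k≤m) = ∈-++⁺ˡ (Equivalence.from (∈⇔ T) (p , k≤m))
  ... | inj₂ k≡1+m     = ∈-++⁺ʳ L (Equivalence.from (∈⇔′ T) (p , k≡1+m))

NumberOf-sumUpTo : ∀ {P : Tree → Set} (key : Tree → ℕ) m {c : ℕ → ℕ} → (∀ T → P T → key T ≤ m) →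
  (∀ i → NumberOf (λ T → P T × key T ≡ i) (c i)) → NumberOf P (sumUpTo m c)
NumberOf-sumUpTo key m bounded count =
  NumberOf-⇔ (λ T → mk⇔ proj₁ (λ p → p , bounded T p)) (NumberOf-byKey key count m)

leaf : Tree
leaf = node []

NonLeaf : Tree → Set
NonLeaf (node [])      = ⊥
NonLeaf (node (_ ∷ _)) = ⊤

mutual
  leaves≤edges : ∀ T → oldLeaves T + youngLeaves T ≤ edges T
  leaves≤edges (node [])       = z≤n
  leaves≤edges (node (T ∷ Ts)) = ≤-trans (≤-reflexive (regroup (isLeaf T) (oldLeaves T) (oldLeavesL Ts) (youngLeaves T) (youngLeavesL Ts)))
    (+-mono-≤ (child-leaves≤edges T) (leavesL≤edgesL Ts))
    where
    regroup : ∀ i o o′ y y′ → i + o + o′ + (y + y′) ≡ i + (o + y) + (o′ + y′)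
    regroup = solve-∀

  child-leaves≤edges : ∀ T → isLeaf T + (oldLeaves T + youngLeaves T) ≤ suc (edges T)
  child-leaves≤edges (node [])      = s≤s z≤n
  child-leaves≤edges T@(node (_ ∷ _)) = m≤n⇒m≤1+n (leaves≤edges T)

  leavesL≤edgesL : ∀ Ts → oldLeavesL Ts + youngLeavesL Ts ≤ edgesL Ts
  leavesL≤edgesL []       = z≤n
  leavesL≤edgesL (T ∷ Ts) = ≤-trans (≤-reflexive (regroup (isLeaf T) (oldLeaves T) (oldLeavesL Ts) (youngLeaves T) (youngLeavesL Ts)))
    (+-mono-≤ (child-leaves≤edges T) (leavesL≤edgesL Ts))
    where
    regroup : ∀ i o o′ y y′ → o + o′ + (i + y + y′) ≡ i + (o + y) + (o′ + y′)
    regroup = solve-∀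

oldLeaves≤edges : ∀ T → oldLeaves T ≤ edges T
oldLeaves≤edges T = ≤-trans (m≤m+n _ _) (leaves≤edges T)

youngLeaves≤edges : ∀ T → youngLeaves T ≤ edges T
youngLeaves≤edges T = ≤-trans (m≤n+m _ _) (leaves≤edges T)

edgeSum oldSum youngSum : List Tree → ℕ
edgeSum  F = sum (map edges F)
oldSum   F = sum (map oldLeaves F)
youngSum F = sum (map youngLeaves F)

-- t + s is the number of internal non-root vertices, so the balance equation counts the lower
-- endpoints of the n edges.
record Profile (n k t j s : ℕ) (F : List Tree) : Set where
  constructor profile
  field
    allNonLeaf : All NonLeaf F
    length≡    : length F ≡ k
    edgeSum≡   : edgeSum F ≡ n
    oldSum≡    : oldSum F ≡ k + t
    youngSum≡  : youngSum F ≡ j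
    balance    : n ≡ k + t + (j + t) + s

plant raise sprout graft : List Tree → List Tree
plant F = node (leaf ∷ []) ∷ F

raise []      = []
raise (T ∷ F) = node (T ∷ []) ∷ F

sprout (node (c ∷ cs) ∷ F) = node (c ∷ leaf ∷ cs) ∷ F
sprout F                   = F

-- The junk value on forests without two leading non-leaf trees is chosen to keep graft injective.
graft (node (c ∷ cs) ∷ T ∷ F) = node (c ∷ T ∷ cs) ∷ F
graft F                       = leaf ∷ F

raise-edgeSum : ∀ T F → edgeSum (raise (T ∷ F)) ≡ suc (edgeSum (T ∷ F))
raise-edgeSum T F = cong (λ x → suc (x + edgeSum F)) (+-identityʳ (edges T))

raise-oldSum : ∀ T F → oldSum (raise (T ∷ F)) ≡ isLeaf T + oldSum (T ∷ F)
raise-oldSum T F = begin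
  isLeaf T + oldLeaves T + 0 + oldSum F ≡⟨ cong (_+ oldSum F) (+-identityʳ _) ⟩
  isLeaf T + oldLeaves T + oldSum F     ≡⟨ +-assoc (isLeaf T) _ _ ⟩
  isLeaf T + oldSum (T ∷ F)             ∎

raise-youngSum : ∀ T F → youngSum (raise (T ∷ F)) ≡ youngSum (T ∷ F)
raise-youngSum T F = cong (_+ youngSum F) (+-identityʳ (youngLeaves T))

sprout-edgeSum : ∀ c cs F → edgeSum (sprout (node (c ∷ cs) ∷ F)) ≡ suc (edgeSum (node (c ∷ cs) ∷ F))
sprout-edgeSum c cs F = cong (λ x → suc (x + edgeSum F)) (+-suc (edges c) (edgesL cs))

sprout-youngSum : ∀ c cs F → youngSum (sprout (node (c ∷ cs) ∷ F)) ≡ suc (youngSum (node (c ∷ cs) ∷ F))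
sprout-youngSum c cs F = cong (_+ youngSum F) (+-suc (youngLeaves c) (youngLeavesL cs))

graft-edgeSum : ∀ c cs T F → edgeSum (graft (node (c ∷ cs) ∷ T ∷ F)) ≡ suc (edgeSum (node (c ∷ cs) ∷ T ∷ F))
graft-edgeSum c cs T F = cong suc (shuffle (edges c) (edges T) (edgesL cs) (edgeSum F))
  where
  shuffle : ∀ a b c r → a + suc (b + c) + r ≡ suc (a + c) + (b + r)
  shuffle = solve-∀

graft-oldSum : ∀ c cs T F → oldSum (graft (node (c ∷ cs) ∷ T ∷ F)) ≡ oldSum (node (c ∷ cs) ∷ T ∷ F)
graft-oldSum c cs T F = shuffle (isLeaf c) (oldLeaves c) (oldLeaves T) (oldLeavesL cs) (oldSum F)
  where
  shuffle : ∀ i a b c r → i + a + (b + c) + r ≡ i + a + c + (b + r)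
  shuffle = solve-∀

graft-youngSum : ∀ c cs T F → youngSum (graft (node (c ∷ cs) ∷ T ∷ F)) ≡ isLeaf T + youngSum (node (c ∷ cs) ∷ T ∷ F)
graft-youngSum c cs T F = shuffle (youngLeaves c) (isLeaf T) (youngLeaves T) (youngLeavesL cs) (youngSum F)
  where
  shuffle : ∀ a i b c r → a + (i + b + c) + r ≡ i + (a + c + (b + r))
  shuffle = solve-∀

plant-profile : ∀ {n k t j s F} → Profile n k t j s F → Profile (suc n) (suc k) t j s (plant F)
plant-profile (profile ps l e o y b) = profile (tt ∷ ps) (cong suc l) (cong suc e) (cong suc o) y (cong suc b)

raise-profile : ∀ {n k t j s F} → Profile n (suc k) t j s F → Profile (suc n) (suc k) t j (suc s) (raise F)
raise-profile {k = k} {t} {j} {s} {node (c ∷ cs) ∷ F} (profile (_ ∷ ps) l e o y b) =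
  profile (tt ∷ ps) l
    (trans (raise-edgeSum (node (c ∷ cs)) F) (cong suc e))
    (trans (raise-oldSum (node (c ∷ cs)) F) o)
    (trans (raise-youngSum (node (c ∷ cs)) F) y)
    (trans (cong suc b) (sym (+-suc (suc k + t + (j + t)) s)))

sprout-profile : ∀ {n k t j s F} → Profile n (suc k) t j s F → Profile (suc n) (suc k) t (suc j) s (sprout F)
sprout-profile {k = k} {t} {j} {s} {node (c ∷ cs) ∷ F} (profile (_ ∷ ps) l e o y b) =
  profile (tt ∷ ps) l
    (trans (sprout-edgeSum c cs F) (cong suc e))
    o
    (trans (sprout-youngSum c cs F) (cong suc y))
    (trans (cong suc b) (shift k t j s))
  where
  shift : ∀ k t j s → suc (suc k + t + (j + t) + s) ≡ suc k + t + (suc j + t) + s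
  shift = solve-∀

graft-profile : ∀ {n k t j s F} → Profile n (suc (suc k)) t j s F → Profile (suc n) (suc k) (suc t) j s (graft F)
graft-profile {k = k} {t} {j} {s} {node (c ∷ cs) ∷ T@(node (_ ∷ _)) ∷ F} (profile (_ ∷ _ ∷ ps) l e o y b) =
  profile (tt ∷ ps) (suc-injective l)
    (trans (graft-edgeSum c cs T F) (cong suc e))
    (trans (graft-oldSum c cs T F) (trans o (sym (+-suc (suc k) t))))
    (trans (graft-youngSum c cs T F) y)
    (trans (cong suc b) (shift k t j s))
  where
  shift : ∀ k t j s → suc (suc (suc k) + t + (j + t) + s) ≡ suc k + suc t + (j + suc t) + s
  shift = solve-∀

mutual
  forests : ℕ → ℕ → ℕ → ℕ → ℕ → List (List Tree)
  forests zero    zero    zero zero zero = [] ∷ []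
  forests zero    _       _    _    _    = []
  forests (suc n) zero    t    j    s    = []
  forests (suc n) (suc k) t    j    s    =
    planted n k t j s ++ raised n k t j s ++ sprouted n k t j s ++ grafted n k t j s

  planted raised sprouted grafted : ℕ → ℕ → ℕ → ℕ → ℕ → List (List Tree)
  planted n k t j s = map plant (forests n k t j s)

  raised n k t j zero    = []
  raised n k t j (suc s) = map raise (forests n (suc k) t j s)

  sprouted n k t zero    s = []
  sprouted n k t (suc j) s = map sprout (forests n (suc k) t j s)

  grafted n k zero    j s = []
  grafted n k (suc t) j s = map graft (forests n (suc (suc k)) t j s)

mutual
  forests-sound : ∀ {n k t j s F} → F ∈ forests n k t j s → Profile n k t j s F
  forests-sound {zero} {zero} {zero} {zero} {zero} (here refl) = profile [] refl refl refl refl refl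
  forests-sound {zero} {zero} {zero} {zero} {suc _} ()
  forests-sound {zero} {zero} {zero} {suc _}        ()
  forests-sound {zero} {zero} {suc _}               ()
  forests-sound {zero} {suc _}                      ()
  forests-sound {suc n} {suc k} {t} {j} {s} F∈ with ∈-++⁻ (planted n k t j s) F∈
  ... | inj₁ F∈p = mapped-sound {n} {k} {t} {j} {s} plant plant-profile F∈p
  ... | inj₂ F∈′ with ∈-++⁻ (raised n k t j s) F∈′
  ...   | inj₁ F∈r = raised-sound s F∈r
  ...   | inj₂ F∈″ with ∈-++⁻ (sprouted n k t j s) F∈″
  ...     | inj₁ F∈sp = sprouted-sound j F∈sp
  ...     | inj₂ F∈g  = grafted-sound t F∈g

  mapped-sound : ∀ {n k t j s n′ k′ t′ j′ s′} f →
                 (∀ {G} → Profile n k t j s G → Profile n′ k′ t′ j′ s′ (f G)) →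
                 ∀ {F} → F ∈ map f (forests n k t j s) → Profile n′ k′ t′ j′ s′ F
  mapped-sound f preserves F∈ with ∈-map⁻ f F∈
  ... | _ , G∈ , refl = preserves (forests-sound G∈)

  raised-sound : ∀ {n k t j} s {F} → F ∈ raised n k t j s → Profile (suc n) (suc k) t j s F
  raised-sound {n} {k} {t} {j} (suc s) = mapped-sound {n} {suc k} {t} {j} {s} raise raise-profile

  sprouted-sound : ∀ {n k t s} j {F} → F ∈ sprouted n k t j s → Profile (suc n) (suc k) t j s F
  sprouted-sound {n} {k} {t} {s} (suc j) = mapped-sound {n} {suc k} {t} {j} {s} sprout sprout-profile

  grafted-sound : ∀ {n k j s} t {F} → F ∈ grafted n k t j s → Profile (suc n) (suc k) t j s F
  grafted-sound {n} {k} {j} {s} (suc t) = mapped-sound {n} {suc (suc k)} {t} {j} {s} graft graft-profile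

∈-planted : ∀ n k t j s {F} → F ∈ forests n k t j s → plant F ∈ forests (suc n) (suc k) t j s
∈-planted _ _ _ _ _ F∈ = ∈-++⁺ˡ (∈-map⁺ plant F∈)

∈-raised : ∀ n k t j s {F} → F ∈ forests n (suc k) t j s → raise F ∈ forests (suc n) (suc k) t j (suc s)
∈-raised n k t j s F∈ = ∈-++⁺ʳ (planted n k t j (suc s)) (∈-++⁺ˡ (∈-map⁺ raise F∈))

∈-sprouted : ∀ n k t j s {F} → F ∈ forests n (suc k) t j s → sprout F ∈ forests (suc n) (suc k) t (suc j) s
∈-sprouted n k t j s F∈ =
  ∈-++⁺ʳ (planted n k t (suc j) s) (∈-++⁺ʳ (raised n k t (suc j) s) (∈-++⁺ˡ (∈-map⁺ sprout F∈)))

∈-grafted : ∀ n k t j s {F} → F ∈ forests n (suc (suc k)) t j s → graft F ∈ forests (suc n) (suc k) (suc t) j s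
∈-grafted n k t j s F∈ =
  ∈-++⁺ʳ (planted n k (suc t) j s) (∈-++⁺ʳ (raised n k (suc t) j s)
    (∈-++⁺ʳ (sprouted n k (suc t) j s) (∈-map⁺ graft F∈)))

forests-complete : ∀ n F → All NonLeaf F → edgeSum F ≡ n →
                   ∃₂ λ t s → F ∈ forests n (length F) t (youngSum F) s
forests-complete zero    []                  _            _ = 0 , 0 , here refl
forests-complete zero    (node [] ∷ _)       (() ∷ _)     _
forests-complete (suc n) (node [] ∷ _)       (() ∷ _)     _
forests-complete (suc n) (node (node [] ∷ []) ∷ F) (_ ∷ ps) e
  with forests-complete n F ps (suc-injective e)
... | t , s , F∈ = t , s , ∈-planted n (length F) t (youngSum F) s F∈
forests-complete (suc n) (node (T@(node (_ ∷ _)) ∷ []) ∷ F) (_ ∷ ps) e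
  with forests-complete n (T ∷ F) (tt ∷ ps) (suc-injective (trans (sym (raise-edgeSum T F)) e))
... | t , s , F∈ = t , suc s ,
  subst (λ j → raise (T ∷ F) ∈ forests (suc n) (suc (length F)) t j (suc s)) (sym (raise-youngSum T F))
    (∈-raised n (length F) t (youngSum (T ∷ F)) s F∈)
forests-complete (suc n) (node (c ∷ node [] ∷ cs) ∷ F) (_ ∷ ps) e
  with forests-complete n (node (c ∷ cs) ∷ F) (tt ∷ ps) (suc-injective (trans (sym (sprout-edgeSum c cs F)) e))
... | t , s , F∈ = t , s ,
  subst (λ j → sprout (node (c ∷ cs) ∷ F) ∈ forests (suc n) (suc (length F)) t j s) (sym (sprout-youngSum c cs F))
    (∈-sprouted n (length F) t (youngSum (node (c ∷ cs) ∷ F)) s F∈)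
forests-complete (suc n) (node (c ∷ T@(node (_ ∷ _)) ∷ cs) ∷ F) (_ ∷ ps) e
  with forests-complete n (node (c ∷ cs) ∷ T ∷ F) (tt ∷ tt ∷ ps) (suc-injective (trans (sym (graft-edgeSum c cs T F)) e))
... | t , s , F∈ = suc t , s ,
  subst (λ j → graft (node (c ∷ cs) ∷ T ∷ F) ∈ forests (suc n) (suc (length F)) (suc t) j s) (sym (graft-youngSum c cs T F))
    (∈-grafted n (length F) t (youngSum (node (c ∷ cs) ∷ T ∷ F)) s F∈)

unplant unraise unsprout ungraft : List Tree → List Tree
unplant []      = []
unplant (_ ∷ F) = F

unraise (node (T ∷ []) ∷ F) = T ∷ F
unraise F                   = F

unsprout (node (c ∷ _ ∷ cs) ∷ F) = node (c ∷ cs) ∷ F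
unsprout F                       = F

ungraft (node (c ∷ T ∷ cs) ∷ F) = node (c ∷ cs) ∷ T ∷ F
ungraft (_ ∷ F)                 = F
ungraft []                      = []

unplant-plant : ∀ F → unplant (plant F) ≡ F
unplant-plant F = refl

unraise-raise : ∀ F → unraise (raise F) ≡ F
unraise-raise []      = refl
unraise-raise (_ ∷ _) = refl

unsprout-sprout : ∀ F → unsprout (sprout F) ≡ F
unsprout-sprout []                  = refl
unsprout-sprout (node []      ∷ _) = refl
unsprout-sprout (node (_ ∷ _) ∷ _) = refl

ungraft-graft : ∀ F → ungraft (graft F) ≡ F
ungraft-graft []                           = refl
ungraft-graft (node []      ∷ _)           = refl
ungraft-graft (node (_ ∷ _) ∷ [])          = refl
ungraft-graft (node (_ ∷ _) ∷ _ ∷ _)       = refl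

rootShape : List Tree → ℕ
rootShape (node (_ ∷ node []      ∷ _) ∷ _) = 3
rootShape (node (_ ∷ node (_ ∷ _) ∷ _) ∷ _) = 4
rootShape (node (node []      ∷ []) ∷ _)    = 1
rootShape (node (node (_ ∷ _) ∷ []) ∷ _)    = 2
rootShape _                                 = 0

HasShape ShapeAbove : ℕ → List Tree → Set
HasShape   a F = rootShape F ≡ a
ShapeAbove a F = a < rootShape F

raise-shape : ∀ {n k t j s F} → Profile n (suc k) t j s F → HasShape 2 (raise F)
raise-shape {F = node (_ ∷ _) ∷ _} _ = refl
raise-shape {F = node [] ∷ _} (profile (() ∷ _) _ _ _ _ _)

sprout-shape : ∀ {n k t j s F} → Profile n (suc k) t j s F → HasShape 3 (sprout F)
sprout-shape {F = node (_ ∷ _) ∷ _} _ = refl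
sprout-shape {F = node [] ∷ _} (profile (() ∷ _) _ _ _ _ _)

graft-shape : ∀ {n k t j s F} → Profile n (suc (suc k)) t j s F → HasShape 4 (graft F)
graft-shape {F = node (_ ∷ _) ∷ node (_ ∷ _) ∷ _} _ = refl
graft-shape {F = node [] ∷ _} (profile (() ∷ _) _ _ _ _ _)
graft-shape {F = node (_ ∷ _) ∷ node [] ∷ _} (profile (_ ∷ () ∷ _) _ _ _ _ _)

mapped-shape : ∀ {n k t j s a} f → (∀ {G} → Profile n k t j s G → HasShape a (f G)) →
               All (HasShape a) (map f (forests n k t j s))
mapped-shape f shape = All.map⁺ (All.tabulate (λ G∈ → shape (forests-sound G∈)))

shape-above : ∀ {a b xs} → a < b → All (HasShape b) xs → All (ShapeAbove a) xs
shape-above a<b = All.map (λ shape≡b → subst (_ <_) (sym shape≡b) a<b)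

Disjoint-shapes : ∀ {a xs ys} → All (HasShape a) xs → All (ShapeAbove a) ys → Disjoint xs ys
Disjoint-shapes shapes above = All-disjoint shapes above (λ shape≡a a<shape → <-irrefl (sym shape≡a) a<shape)

forests-unique : ∀ n k t j s → Unique (forests n k t j s)
forests-unique zero    zero    zero    zero    zero    = [] ∷ []
forests-unique zero    zero    zero    zero    (suc _) = []
forests-unique zero    zero    zero    (suc _) _       = []
forests-unique zero    zero    (suc _) _       _       = []
forests-unique zero    (suc _) _       _       _       = []
forests-unique (suc n) zero    _       _       _       = []
forests-unique (suc n) (suc k) t j s =
  Unique.++⁺ (Unique-map-inverse unplant unplant-plant (forests-unique n k t j s))
    (Unique.++⁺ (raised-unique s) (Unique.++⁺ (sprouted-unique j) (grafted-unique t) sprouted#grafted) raised#rest)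
    planted#rest
  where
  raised-unique : ∀ s → Unique (raised n k t j s)
  raised-unique zero    = []
  raised-unique (suc s) = Unique-map-inverse unraise unraise-raise (forests-unique n (suc k) t j s)
  sprouted-unique : ∀ j → Unique (sprouted n k t j s)
  sprouted-unique zero    = []
  sprouted-unique (suc j) = Unique-map-inverse unsprout unsprout-sprout (forests-unique n (suc k) t j s)
  grafted-unique : ∀ t → Unique (grafted n k t j s)
  grafted-unique zero    = []
  grafted-unique (suc t) = Unique-map-inverse ungraft ungraft-graft (forests-unique n (suc (suc k)) t j s)
  raised-shape : ∀ s → All (HasShape 2) (raised n k t j s)
  raised-shape zero    = []
  raised-shape (suc s) = mapped-shape {n} {suc k} {t} {j} {s} raise raise-shape
  sprouted-shape : ∀ j → All (HasShape 3) (sprouted n k t j s)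
  sprouted-shape zero    = []
  sprouted-shape (suc j) = mapped-shape {n} {suc k} {t} {j} {s} sprout sprout-shape
  grafted-shape : ∀ t → All (HasShape 4) (grafted n k t j s)
  grafted-shape zero    = []
  grafted-shape (suc t) = mapped-shape {n} {suc (suc k)} {t} {j} {s} graft graft-shape
  sprouted#grafted : Disjoint (sprouted n k t j s) (grafted n k t j s)
  sprouted#grafted = Disjoint-shapes (sprouted-shape j) (shape-above (s<s (s<s (s<s z<s))) (grafted-shape t))
  raised#rest : Disjoint (raised n k t j s) (sprouted n k t j s ++ grafted n k t j s)
  raised#rest = Disjoint-shapes (raised-shape s)
    (All.++⁺ (shape-above (s<s (s<s z<s)) (sprouted-shape j)) (shape-above (s<s (s<s z<s)) (grafted-shape t)))
  planted#rest : Disjoint (planted n k t j s) (raised n k t j s ++ sprouted n k t j s ++ grafted n k t j s)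
  planted#rest = Disjoint-shapes (All.map⁺ (All.tabulate (λ _ → refl)))
    (All.++⁺ (shape-above (s<s z<s) (raised-shape s))
      (All.++⁺ (shape-above (s<s z<s) (sprouted-shape j)) (shape-above (s<s z<s) (grafted-shape t))))

CountFormula : ℕ → Set
CountFormula n = ∀ k t j s → n ≡ k + t + (j + t) + s →
  n * length (forests n k t j s) * factorials (k + t) j t s ≡ k * n !

module _ {n} (ih : CountFormula n) where

  planted-count : ∀ k t j s → suc n ≡ suc k + t + (j + t) + s →
    n * length (planted n k t j s) * factorials (suc k + t) j t s ≡ suc (k + t) * (k * n !)
  planted-count k t j s balance = begin
    n * length (map plant F) * factorials (suc k + t) j t s
      ≡⟨ cong (λ x → n * x * factorials (suc k + t) j t s) (length-map plant F) ⟩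
    n * length F * ((suc (k + t) * (k + t) !) * (j ! * (t ! * s !)))
      ≡⟨ pull n (length F) (suc (k + t)) ((k + t) !) (j ! * (t ! * s !)) ⟩
    suc (k + t) * (n * length F * factorials (k + t) j t s)
      ≡⟨ cong (suc (k + t) *_) (ih k t j s (suc-injective balance)) ⟩
    suc (k + t) * (k * n !) ∎
    where
    F = forests n k t j s
    pull : ∀ n L a A R → n * L * ((a * A) * R) ≡ a * (n * L * (A * R))
    pull = solve-∀

  raised-count : ∀ k t j s → suc n ≡ suc k + t + (j + t) + s →
    n * length (raised n k t j s) * factorials (suc k + t) j t s ≡ s * (suc k * n !)
  raised-count k t j zero    _       = cong (_* factorials (suc k + t) j t zero) (*-zeroʳ n)
  raised-count k t j (suc s) balance = begin
    n * length (map raise F) * factorials (suc k + t) j t (suc s)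
      ≡⟨ cong (λ x → n * x * factorials (suc k + t) j t (suc s)) (length-map raise F) ⟩
    n * length F * ((suc k + t) ! * (j ! * (t ! * (suc s * s !))))
      ≡⟨ pull n (length F) (suc s) ((suc k + t) !) (j !) (t !) (s !) ⟩
    suc s * (n * length F * factorials (suc k + t) j t s)
      ≡⟨ cong (suc s *_) (ih (suc k) t j s (suc-injective (trans balance (+-suc _ s)))) ⟩
    suc s * (suc k * n !) ∎
    where
    F = forests n (suc k) t j s
    pull : ∀ n L a A B C S → n * L * (A * (B * (C * (a * S)))) ≡ a * (n * L * (A * (B * (C * S))))
    pull = solve-∀

  sprouted-count : ∀ k t j s → suc n ≡ suc k + t + (j + t) + s →
    n * length (sprouted n k t j s) * factorials (suc k + t) j t s ≡ j * (suc k * n !)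
  sprouted-count k t zero    s _       = cong (_* factorials (suc k + t) zero t s) (*-zeroʳ n)
  sprouted-count k t (suc j) s balance = begin
    n * length (map sprout F) * factorials (suc k + t) (suc j) t s
      ≡⟨ cong (λ x → n * x * factorials (suc k + t) (suc j) t s) (length-map sprout F) ⟩
    n * length F * ((suc k + t) ! * ((suc j * j !) * (t ! * s !)))
      ≡⟨ pull n (length F) (suc j) ((suc k + t) !) (j !) (t ! * s !) ⟩
    suc j * (n * length F * factorials (suc k + t) j t s)
      ≡⟨ cong (suc j *_) (ih (suc k) t j s (suc-injective (trans balance (shift (suc k + t) j t s)))) ⟩
    suc j * (suc k * n !) ∎
    where
    F = forests n (suc k) t j s
    pull : ∀ n L a A B R → n * L * (A * ((a * B) * R)) ≡ a * (n * L * (A * (B * R)))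
    pull = solve-∀
    shift : ∀ a j t s → a + (suc j + t) + s ≡ suc (a + (j + t) + s)
    shift = solve-∀

  grafted-count : ∀ k t j s → suc n ≡ suc k + t + (j + t) + s →
    n * length (grafted n k t j s) * factorials (suc k + t) j t s ≡ t * (suc (suc k) * n !)
  grafted-count k zero    j s _       = cong (_* factorials (suc k + zero) j zero s) (*-zeroʳ n)
  grafted-count k (suc t) j s balance = begin
    n * length (map graft F) * factorials (suc k + suc t) j (suc t) s
      ≡⟨ cong (λ x → n * x * factorials (suc k + suc t) j (suc t) s) (length-map graft F) ⟩
    n * length F * ((suc k + suc t) ! * (j ! * ((suc t * t !) * s !)))
      ≡⟨ cong (λ x → n * length F * (x ! * (j ! * ((suc t * t !) * s !)))) (+-suc (suc k) t) ⟩
    n * length F * ((suc (suc k) + t) ! * (j ! * ((suc t * t !) * s !)))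
      ≡⟨ pull n (length F) (suc t) ((suc (suc k) + t) !) (j !) (t !) (s !) ⟩
    suc t * (n * length F * factorials (suc (suc k) + t) j t s)
      ≡⟨ cong (suc t *_) (ih (suc (suc k)) t j s (suc-injective (trans balance (shift k t j s)))) ⟩
    suc t * (suc (suc k) * n !) ∎
    where
    F = forests n (suc (suc k)) t j s
    pull : ∀ n L a A B C S → n * L * (A * (B * ((a * C) * S))) ≡ a * (n * L * (A * (B * (C * S))))
    pull = solve-∀
    shift : ∀ k t j s → suc k + suc t + (j + suc t) + s ≡ suc (suc (suc k) + t + (j + t) + s)
    shift = solve-∀

  forests-count-step : .{{NonZero n}} → ∀ k t j s → suc n ≡ suc k + t + (j + t) + s →
    length (forests (suc n) (suc k) t j s) * factorials (suc k + t) j t s ≡ suc k * n !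
  forests-count-step k t j s balance = *-cancelˡ-≡ _ _ n (begin
    n * (length (P ++ R ++ S ++ G) * D)
      ≡⟨ cong (λ x → n * (x * D)) length-parts ⟩
    n * ((length P + (length R + (length S + length G))) * D)
      ≡⟨ distribute n (length P) (length R) (length S) (length G) D ⟩
    n * length P * D + (n * length R * D + (n * length S * D + n * length G * D))
      ≡⟨ cong₂ _+_ (planted-count k t j s balance) (cong₂ _+_ (raised-count k t j s balance)
           (cong₂ _+_ (sprouted-count k t j s balance) (grafted-count k t j s balance))) ⟩
    suc (k + t) * (k * n !) + (s * (suc k * n !) + (j * (suc k * n !) + t * (suc (suc k) * n !)))
      ≡⟨ weights k t j s (n !) ⟩
    (k + t + (j + t) + s) * (suc k * n !)
      ≡⟨ cong (_* (suc k * n !)) (sym (suc-injective balance)) ⟩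
    n * (suc k * n !) ∎)
    where
    P = planted n k t j s
    R = raised n k t j s
    S = sprouted n k t j s
    G = grafted n k t j s
    D = factorials (suc k + t) j t s
    length-parts : length (P ++ R ++ S ++ G) ≡ length P + (length R + (length S + length G))
    length-parts = trans (length-++ P) (cong (length P +_) (trans (length-++ R) (cong (length R +_) (length-++ S))))
    distribute : ∀ n a b c d D → n * ((a + (b + (c + d))) * D) ≡ n * a * D + (n * b * D + (n * c * D + n * d * D))
    distribute = solve-∀
    weights : ∀ k t j s N → suc (k + t) * (k * N) + (s * (suc k * N) + (j * (suc k * N) + t * (suc (suc k) * N)))
                            ≡ (k + t + (j + t) + s) * (suc k * N)
    weights = solve-∀

forests-count : ∀ n → CountFormula n
forests-count zero    zero    t j s _ = refl
forests-count zero    (suc k) t j s ()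
forests-count (suc n) zero    t j s _ = cong (_* factorials t j t s) (*-zeroʳ (suc n))
forests-count 1 1 zero    zero    zero    refl = refl
forests-count 1 1 zero    zero    (suc s) ()
forests-count 1 1 zero    (suc j) s       ()
forests-count 1 1 (suc t) j       s       ()
forests-count 1 (suc (suc k)) t j s ()
forests-count (suc n@(suc _)) (suc k) t j s balance = begin
  suc n * length F * D     ≡⟨ *-assoc (suc n) (length F) D ⟩
  suc n * (length F * D)   ≡⟨ cong (suc n *_) (forests-count-step (forests-count n) k t j s balance) ⟩
  suc n * (suc k * n !)    ≡⟨ x∙yz≈y∙xz (suc n) (suc k) (n !) ⟩
  suc k * (suc n * n !)    ∎
  where
  F = forests (suc n) (suc k) t j s
  D = factorials (suc k + t) j t s

firstTree : List Tree → Tree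
firstTree []      = leaf
firstTree (T ∷ _) = T

-- The last index is the only s allowed by the balance equation; when no such s exists the
-- truncated subtraction gives a junk value, harmless since the list is then empty.
trees : ℕ → ℕ → ℕ → List Tree
trees n zero    j = []
trees n (suc t) j = map firstTree (forests n 1 t j (n ∸ (suc t + (j + t))))

singleton-profile : ∀ {n t j s F} → Profile n 1 t j s F → [ firstTree F ] ≡ F
singleton-profile {F = _ ∷ []}    _                   = refl
singleton-profile {F = []}        (profile _ () _ _ _ _)
singleton-profile {F = _ ∷ _ ∷ _} (profile _ () _ _ _ _)

firstTree-statistics : ∀ {n t j s F} → Profile n 1 t j s F →
  edges (firstTree F) ≡ n × oldLeaves (firstTree F) ≡ suc t × youngLeaves (firstTree F) ≡ j
firstTree-statistics {F = T ∷ []} (profile _ _ e o y _) = drop+0 e , drop+0 o , drop+0 y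
  where
  drop+0 : ∀ {a b} → a + 0 ≡ b → a ≡ b
  drop+0 {a} = trans (sym (+-identityʳ a))
firstTree-statistics {F = []}        (profile _ () _ _ _ _)
firstTree-statistics {F = _ ∷ _ ∷ _} (profile _ () _ _ _ _)

∈-trees⁻ : ∀ {n i j T} → T ∈ trees n i j → edges T ≡ n × oldLeaves T ≡ i × youngLeaves T ≡ j
∈-trees⁻ {i = suc t} T∈ with ∈-map⁻ firstTree T∈
... | F , F∈ , refl = firstTree-statistics (forests-sound F∈)

∈-trees⁺ : ∀ {n T} → 1 ≤ n → edges T ≡ n → T ∈ trees n (oldLeaves T) (youngLeaves T)
∈-trees⁺ {T = node []}      ()  refl
∈-trees⁺ {T = T@(node (_ ∷ _))} _ refl with forests-complete _ [ T ] (tt ∷ []) (+-identityʳ (edges T))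
... | t , s , [T]∈ = subst (λ i → T ∈ trees (edges T) i y) (sym old≡) (∈-map⁺ firstTree [T]∈′)
  where
  y = youngLeaves T
  [T]∈″ : [ T ] ∈ forests (edges T) 1 t y s
  [T]∈″ = subst (λ j → [ T ] ∈ forests (edges T) 1 t j s) (+-identityʳ y) [T]∈
  prof : Profile (edges T) 1 t y s [ T ]
  prof = forests-sound [T]∈″
  old≡ : oldLeaves T ≡ suc t
  old≡ = trans (sym (+-identityʳ _)) (Profile.oldSum≡ prof)
  s≡ : s ≡ edges T ∸ (suc t + (y + t))
  s≡ = sym (trans (cong (_∸ (suc t + (y + t))) (Profile.balance prof)) (m+n∸m≡n (suc t + (y + t)) s))
  [T]∈′ : [ T ] ∈ forests (edges T) 1 t y (edges T ∸ (suc t + (y + t)))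
  [T]∈′ = subst (λ s → [ T ] ∈ forests (edges T) 1 t y s) s≡ [T]∈″

trees-unique : ∀ n i j → Unique (trees n i j)
trees-unique n zero    j = []
trees-unique n (suc t) j = Unique.map⁻ (subst Unique (sym map[_]∘firstTree≡id) (forests-unique n 1 t j s))
  where
  s  = n ∸ (suc t + (j + t))
  Fs = forests n 1 t j s
  map[_]∘firstTree≡id : map [_] (map firstTree Fs) ≡ Fs
  map[_]∘firstTree≡id = trans (sym (map-∘ Fs))
    (map-id-local (All.tabulate (λ F∈ → singleton-profile (forests-sound {n} {1} {t} {j} {s} F∈))))

trees-NumberOf : ∀ {n} → 1 ≤ n → ∀ i j →
  NumberOf (λ T → edges T ≡ n × oldLeaves T ≡ i × youngLeaves T ≡ j) (length (trees n i j))
trees-NumberOf {n} 1≤n i j =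
  trees n i j , trees-unique n i j ,
  (λ T → mk⇔ ∈-trees⁻ (λ (e , o , y) → subst₂ (λ i j → T ∈ trees n i j) o y (∈-trees⁺ 1≤n e))) ,
  refl

trees-factorial : ∀ t j s →
  length (trees (suc t + (j + t) + s) (suc t) j) * factorials (suc t) j t s ≡ (t + (j + t) + s) !
trees-factorial t j s = *-cancelˡ-≡ _ _ n (begin
  n * (length (map firstTree (forests n 1 t j (n ∸ (suc t + (j + t))))) * D)
    ≡⟨ cong (λ x → n * (length (map firstTree (forests n 1 t j x)) * D)) (m+n∸m≡n (suc t + (j + t)) s) ⟩
  n * (length (map firstTree (forests n 1 t j s)) * D)
    ≡⟨ cong (λ x → n * (x * D)) (length-map firstTree (forests n 1 t j s)) ⟩
  n * (length (forests n 1 t j s) * D)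
    ≡⟨ sym (*-assoc n (length (forests n 1 t j s)) D) ⟩
  n * length (forests n 1 t j s) * D
    ≡⟨ forests-count n 1 t j s refl ⟩
  1 * n !
    ≡⟨ *-identityˡ (n !) ⟩
  n * (t + (j + t) + s) ! ∎)
  where
  n = suc t + (j + t) + s
  D = factorials (suc t) j t s

trees-empty : ∀ {n t j} → n < suc t + (j + t) → length (trees n (suc t) j) ≡ 0
trees-empty {n} {t} {j} n<min = trans (length-map firstTree Fs) (cong length (no-members⇒[] too-small))
  where
  Fs = forests n 1 t j (n ∸ (suc t + (j + t)))
  no-members⇒[] : ∀ {xs : List (List Tree)} → (∀ {x} → x ∉ xs) → xs ≡ []
  no-members⇒[] {[]}    _  = refl
  no-members⇒[] {_ ∷ _} ∉xs = ⊥-elim (∉xs (here refl))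
  too-small : ∀ {F} → F ∉ Fs
  too-small F∈ = <⇒≱ n<min (subst (_ ≤_) (sym (Profile.balance (forests-sound F∈))) (m≤m+n _ _))

-- The three closed forms below are proved alike: if m = t + (j + t) + s for some s, both sides
-- agree after multiplication by a product of factorials; otherwise both sides vanish.
suc*length-trees≡choose₃ : ∀ m t j → suc m * length (trees (suc m) (suc t) j) ≡ choose₃ (suc m) (suc t) j t
suc*length-trees≡choose₃ m t j with ≤-<-connex (t + (j + t)) m
... | inj₂ m<min = begin
  suc m * length (trees (suc m) (suc t) j) ≡⟨ cong (suc m *_) (trees-empty (s<s m<min)) ⟩
  suc m * 0                                 ≡⟨ *-zeroʳ (suc m) ⟩
  0                                         ≡⟨ sym (choose₃-vanishes (suc t) j t (s<s m<min)) ⟩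
  choose₃ (suc m) (suc t) j t               ∎
... | inj₁ min≤m with m≤n⇒∃[o]m+o≡n min≤m
... | s , refl = *-cancelʳ-≡ _ _ D {{factorials≢0 (suc t) j t s}} (begin
  suc m * length (trees (suc m) (suc t) j) * D   ≡⟨ *-assoc (suc m) (length (trees (suc m) (suc t) j)) D ⟩
  suc m * (length (trees (suc m) (suc t) j) * D) ≡⟨ cong (suc m *_) (trees-factorial t j s) ⟩
  suc m !                                        ≡⟨ sym (choose₃-factorial (suc t) j t s (cong suc (reorder t j s))) ⟩
  choose₃ (suc m) (suc t) j t * D                ∎)
  where
  D = factorials (suc t) j t s
  reorder : ∀ t j s → t + (j + t) + s ≡ t + (j + (t + s))
  reorder = solve-∀

suc*length-trees≡C*C*C : ∀ m t j →
  suc t * length (trees (suc m) (suc t) j) ≡ (m C (t + t)) * ((t + t) C t) * ((m ∸ (t + t)) C j)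
suc*length-trees≡C*C*C m t j with ≤-<-connex (t + (j + t)) m
... | inj₂ m<min = begin
  suc t * length (trees (suc m) (suc t) j)                   ≡⟨ cong (suc t *_) (trees-empty (s<s m<min)) ⟩
  suc t * 0                                                   ≡⟨ *-zeroʳ (suc t) ⟩
  0                                                           ≡⟨ sym (*-zeroʳ ((t + t) C t)) ⟩
  ((t + t) C t) * 0                                           ≡⟨ cong (((t + t) C t) *_) (sym (C*∸-vanishes {m} {t + t} {j} (_C j) k>n⇒nCk≡0 m<2t+j)) ⟩
  ((t + t) C t) * ((m C (t + t)) * ((m ∸ (t + t)) C j))       ≡⟨ x∙yz≈y∙xz ((t + t) C t) (m C (t + t)) _ ⟩
  (m C (t + t)) * (((t + t) C t) * ((m ∸ (t + t)) C j))       ≡⟨ sym (*-assoc (m C (t + t)) _ _) ⟩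
  (m C (t + t)) * ((t + t) C t) * ((m ∸ (t + t)) C j)         ∎
  where
  m<2t+j : m < t + t + j
  m<2t+j = subst (m <_) (reorder t j) m<min
    where
    reorder : ∀ t j → t + (j + t) ≡ t + t + j
    reorder = solve-∀
... | inj₁ min≤m with m≤n⇒∃[o]m+o≡n min≤m
... | s , refl = *-cancelʳ-≡ _ _ D {{factorials≢0 t j t s}} (begin
  suc t * length (trees (suc m) (suc t) j) * D ≡⟨ regroup (suc t) (length (trees (suc m) (suc t) j)) (t !) (j ! * (t ! * s !)) ⟩
  length (trees (suc m) (suc t) j) * factorials (suc t) j t s ≡⟨ trees-factorial t j s ⟩
  m !                                          ≡⟨ sym (C*C*C-factorial t t j s (reorder t j s)) ⟩
  (m C (t + t)) * ((t + t) C t) * ((m ∸ (t + t)) C j) * D ∎)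
  where
  D = factorials t j t s
  regroup : ∀ a c A R → a * c * (A * R) ≡ c * ((a * A) * R)
  regroup = solve-∀
  reorder : ∀ t j s → t + (j + t) + s ≡ t + t + (j + s)
  reorder = solve-∀

length-trees≡C*C*catalan : ∀ m t j →
  length (trees (suc m) (suc t) j) ≡ (m C j) * (((m ∸ j) C (2 * t)) * catalan t)
length-trees≡C*C*catalan m t j with ≤-<-connex (t + (j + t)) m
... | inj₂ m<min = trans (trees-empty (s<s m<min))
  (sym (C*∸-vanishes {m} {j} {2 * t} (λ y → (y C (2 * t)) * catalan t) (λ y<2t → cong (_* catalan t) (k>n⇒nCk≡0 y<2t)) m<j+2t))
  where
  m<j+2t : m < j + 2 * t
  m<j+2t = subst (m <_) (reorder t j) m<min
    where
    reorder : ∀ t j → t + (j + t) ≡ j + 2 * t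
    reorder = solve-∀
... | inj₁ min≤m with m≤n⇒∃[o]m+o≡n min≤m
... | s , refl = *-cancelʳ-≡ _ _ D {{factorials≢0 (suc t) j t s}} (begin
  length (trees (suc m) (suc t) j) * D           ≡⟨ trees-factorial t j s ⟩
  m !                                            ≡⟨ sym (C*C*catalan-factorial j t s (reorder t j s)) ⟩
  (m C j) * (((m ∸ j) C (2 * t)) * catalan t) * D ∎)
  where
  D = factorials (suc t) j t s
  reorder : ∀ t j s → t + (j + t) + s ≡ j + (2 * t + s)
  reorder = solve-∀

trees-NumberOf-old : ∀ {n} → 1 ≤ n → ∀ i →
  NumberOf (λ T → edges T ≡ n × oldLeaves T ≡ i) (sumUpTo n (λ j → length (trees n i j)))
trees-NumberOf-old {n} 1≤n i =
  NumberOf-sumUpTo youngLeaves n (λ T (e , _) → subst (youngLeaves T ≤_) e (youngLeaves≤edges T))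
    (λ j → NumberOf-⇔ (λ T → mk⇔ (λ (e , o , y) → (e , o) , y) (λ ((e , o) , y) → e , o , y))
                      (trees-NumberOf 1≤n i j))

trees-NumberOf-young : ∀ {n} → 1 ≤ n → ∀ j →
  NumberOf (λ T → edges T ≡ n × youngLeaves T ≡ j) (sumUpTo n (λ i → length (trees n i j)))
trees-NumberOf-young {n} 1≤n j =
  NumberOf-sumUpTo oldLeaves n (λ T (e , _) → subst (oldLeaves T ≤_) e (oldLeaves≤edges T))
    (λ i → NumberOf-⇔ (λ T → mk⇔ (λ (e , o , y) → (e , y) , o) (λ ((e , y) , o) → e , o , y))
                      (trees-NumberOf 1≤n i j))

suc*Σ-length-trees≡2^*C*C : ∀ m t →
  suc t * sumUpTo (suc m) (λ j → length (trees (suc m) (suc t) j)) ≡ 2 ^ (m ∸ (t + t)) * (m C (t + t)) * ((t + t) C t)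
suc*Σ-length-trees≡2^*C*C m t = begin
  suc t * sumUpTo (suc m) (λ j → length (trees (suc m) (suc t) j))
    ≡⟨ *-distribˡ-sumUpTo (suc m) (suc t) _ ⟩
  sumUpTo (suc m) (λ j → suc t * length (trees (suc m) (suc t) j))
    ≡⟨ sumUpTo-cong (suc m) (suc*length-trees≡C*C*C m t) ⟩
  sumUpTo (suc m) (λ j → A * (r C j))
    ≡⟨ sym (*-distribˡ-sumUpTo (suc m) A (r C_)) ⟩
  A * sumUpTo (suc m) (r C_)
    ≡⟨ cong (A *_) (sumUpTo-extend (suc m) (r C_) (≤-trans (m∸n≤m m (t + t)) (n≤1+n m)) (λ _ → k>n⇒nCk≡0)) ⟩
  A * sumUpTo r (r C_)
    ≡⟨ cong (A *_) (sumUpTo-C r) ⟩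
  A * 2 ^ r
    ≡⟨ *-comm A (2 ^ r) ⟩
  2 ^ r * A
    ≡⟨ sym (*-assoc (2 ^ r) (m C (t + t)) ((t + t) C t)) ⟩
  2 ^ r * (m C (t + t)) * ((t + t) C t) ∎
  where
  r = m ∸ (t + t)
  A = (m C (t + t)) * ((t + t) C t)

Σ-length-trees≡C*motzkin : ∀ m k → sumUpTo (suc m) (λ i → length (trees (suc m) i k)) ≡ (m C k) * motzkin (m ∸ k)
Σ-length-trees≡C*motzkin m k = begin
  sumUpTo (suc m) (λ i → length (trees (suc m) i k))
    ≡⟨ sumUpTo-suc m (λ i → length (trees (suc m) i k)) ⟩
  sumUpTo m (λ t → length (trees (suc m) (suc t) k))
    ≡⟨ sumUpTo-cong m (λ t → length-trees≡C*C*catalan m t k) ⟩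
  sumUpTo m (λ t → (m C k) * g t)
    ≡⟨ sym (*-distribˡ-sumUpTo m (m C k) g) ⟩
  (m C k) * sumUpTo m g
    ≡⟨ cong ((m C k) *_) (sumUpTo-extend m g (m∸n≤m m k) (λ t r<t → cong (_* catalan t) (k>n⇒nCk≡0 (<-≤-trans r<t (m≤m+n t (t + 0)))))) ⟩
  (m C k) * motzkin (m ∸ k) ∎
  where
  g : ℕ → ℕ
  g t = ((m ∸ k) C (2 * t)) * catalan t

open import Data.Integer using (+_; -[1+_]; _-_)
open import Data.Integer.Properties using ([+m]-[+n]≡m⊖n; ⊖-≥)

[+m]-[+n]≡+[m∸n] : ∀ {m n} → n ≤ m → + m - + n ≡ + (m ∸ n)
[+m]-[+n]≡+[m∸n] {m} {n} n≤m = trans ([+m]-[+n]≡m⊖n m n) (⊖-≥ n≤m)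

binom-negative : ∀ x k → binom x -[1+ k ] ≡ 0
binom-negative (+ _)    k = refl
binom-negative -[1+ _ ] k = refl

binom³≡choose₃ : ∀ n a b c →
  binom (+ n) (+ a) * binom (+ n - + a) (+ b) * binom (+ n - + a - + b) (+ c) ≡ choose₃ n a b c
binom³≡choose₃ n a b c = begin
  (n C a) * binom (+ n - + a) (+ b) * binom (+ n - + a - + b) (+ c)
    ≡⟨ *-assoc (n C a) _ _ ⟩
  (n C a) * (binom (+ n - + a) (+ b) * binom (+ n - + a - + b) (+ c))
    ≡⟨ C*-cong {n} {a} (λ a≤n → cong (λ z → binom z (+ b) * binom (z - + b) (+ c)) ([+m]-[+n]≡+[m∸n] a≤n)) ⟩
  (n C a) * (((n ∸ a) C b) * binom (+ (n ∸ a) - + b) (+ c))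
    ≡⟨ cong ((n C a) *_) (C*-cong {n ∸ a} {b} (λ b≤n∸a → cong (λ z → binom z (+ c)) ([+m]-[+n]≡+[m∸n] b≤n∸a))) ⟩
  choose₃ n a b c ∎

edges*length-trees≡binom³ : ∀ m i j → suc m * length (trees (suc m) i j) ≡
  binom (+ suc m) (+ i) * binom (+ suc m - + i) (+ j) * binom (+ suc m - + i - + j) (+ i - + 1)
edges*length-trees≡binom³ m zero j = begin
  suc m * 0  ≡⟨ *-zeroʳ (suc m) ⟩
  0          ≡⟨ sym (*-zeroʳ (binom (+ suc m) (+ 0) * binom (+ suc m - + 0) (+ j))) ⟩
  binom (+ suc m) (+ 0) * binom (+ suc m - + 0) (+ j) * 0
             ≡⟨ cong (binom (+ suc m) (+ 0) * binom (+ suc m - + 0) (+ j) *_) (sym (binom-negative (+ suc m - + 0 - + j) 0)) ⟩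
  binom (+ suc m) (+ 0) * binom (+ suc m - + 0) (+ j) * binom (+ suc m - + 0 - + j) (+ 0 - + 1) ∎
edges*length-trees≡binom³ m (suc t) j = begin
  suc m * length (trees (suc m) (suc t) j)
    ≡⟨ suc*length-trees≡choose₃ m t j ⟩
  choose₃ (suc m) (suc t) j t
    ≡⟨ sym (binom³≡choose₃ (suc m) (suc t) j t) ⟩
  binom (+ suc m) (+ suc t) * binom (+ suc m - + suc t) (+ j) * binom (+ suc m - + suc t - + j) (+ t)
    ≡⟨ cong (λ z → binom (+ suc m) (+ suc t) * binom (+ suc m - + suc t) (+ j) * binom (+ suc m - + suc t - + j) z)
            (sym ([+m]-[+n]≡+[m∸n] (s≤s z≤n))) ⟩
  binom (+ suc m) (+ suc t) * binom (+ suc m - + suc t) (+ j) * binom (+ suc m - + suc t - + j) (+ suc t - + 1) ∎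

2^*binom*binom≡2^*C*C : ∀ m t →
  2 ^ (suc m + 1 ∸ 2 * suc t) * binom (+ suc m - + 1) (+ (2 * suc t) - + 2) * binom (+ (2 * suc t) - + 2) (+ suc t - + 1)
  ≡ 2 ^ (m ∸ (t + t)) * (m C (t + t)) * ((t + t) C t)
2^*binom*binom≡2^*C*C m t = begin
  2 ^ (suc m + 1 ∸ 2 * suc t) * binom (+ suc m - + 1) (+ (2 * suc t) - + 2) * binom (+ (2 * suc t) - + 2) (+ suc t - + 1)
    ≡⟨ cong₂ (λ e z → 2 ^ e * binom (+ suc m - + 1) z * binom z (+ suc t - + 1)) exponent 2[1+t]-2 ⟩
  2 ^ (m ∸ (t + t)) * binom (+ suc m - + 1) (+ (t + t)) * binom (+ (t + t)) (+ suc t - + 1)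
    ≡⟨ cong₂ (λ x y → 2 ^ (m ∸ (t + t)) * binom x (+ (t + t)) * binom (+ (t + t)) y)
             ([+m]-[+n]≡+[m∸n] {suc m} {1} (s≤s z≤n)) ([+m]-[+n]≡+[m∸n] {suc t} {1} (s≤s z≤n)) ⟩
  2 ^ (m ∸ (t + t)) * (m C (t + t)) * ((t + t) C t) ∎
  where
  2*[1+t]≡2+[t+t] : 2 * suc t ≡ 2 + (t + t)
  2*[1+t]≡2+[t+t] = trans (2*n≡n+n (suc t)) (cong suc (+-suc t t))
  exponent : suc m + 1 ∸ 2 * suc t ≡ m ∸ (t + t)
  exponent = cong₂ _∸_ (+-comm (suc m) 1) 2*[1+t]≡2+[t+t]
  2[1+t]-2 : + (2 * suc t) - + 2 ≡ + (t + t)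
  2[1+t]-2 = trans (cong (λ x → + x - + 2) 2*[1+t]≡2+[t+t]) ([+m]-[+n]≡+[m∸n] (s≤s (s≤s z≤n)))

binom*motzkinℤ≡C*motzkin : ∀ m k → binom (+ suc m - + 1) (+ k) * motzkinℤ (+ suc m - + k - + 1) ≡ (m C k) * motzkin (m ∸ k)
binom*motzkinℤ≡C*motzkin m k = begin
  binom (+ suc m - + 1) (+ k) * motzkinℤ (+ suc m - + k - + 1)
    ≡⟨ cong (λ x → binom x (+ k) * motzkinℤ (+ suc m - + k - + 1)) ([+m]-[+n]≡+[m∸n] (s≤s z≤n)) ⟩
  (m C k) * motzkinℤ (+ suc m - + k - + 1)
    ≡⟨ C*-cong {m} {k} (λ k≤m → cong motzkinℤ (begin
         + suc m - + k - + 1        ≡⟨ cong (_- + 1) ([+m]-[+n]≡+[m∸n] (m≤n⇒m≤1+n k≤m)) ⟩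
         + (suc m ∸ k) - + 1        ≡⟨ cong (λ x → + x - + 1) (+-∸-assoc 1 k≤m) ⟩
         + suc (m ∸ k) - + 1        ≡⟨ [+m]-[+n]≡+[m∸n] (s≤s z≤n) ⟩
         + (m ∸ k)                  ∎)) ⟩
  (m C k) * motzkin (m ∸ k) ∎

mainTheorem2 : (n : ℕ) → 1 ≤ n →
    ((i j : ℕ) → Σ ℕ λ c →
        NumberOf (λ t → edges t ≡ n × oldLeaves t ≡ i × youngLeaves t ≡ j) c
        × n * c ≡ binom (+ n) (+ i) * binom (+ n - + i) (+ j) * binom (+ n - + i - + j) (+ i - + 1))
    × ((k : ℕ) → 1 ≤ k → Σ ℕ λ c →
        NumberOf (λ t → edges t ≡ n × oldLeaves t ≡ k) c
        × k * c ≡ 2 ^ (n + 1 ∸ 2 * k) * binom (+ n - + 1) (+ (2 * k) - + 2) * binom (+ (2 * k) - + 2) (+ k - + 1))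
    × ((k : ℕ) →
        NumberOf (λ t → edges t ≡ n × youngLeaves t ≡ k) (binom (+ n - + 1) (+ k) * motzkinℤ (+ n - + k - + 1)))
mainTheorem2 (suc m) 1≤n =
  (λ i j → length (trees (suc m) i j) , trees-NumberOf 1≤n i j , edges*length-trees≡binom³ m i j) ,
  (λ { zero () ; (suc t) _ →
       _ , trees-NumberOf-old 1≤n (suc t) , trans (suc*Σ-length-trees≡2^*C*C m t) (sym (2^*binom*binom≡2^*C*C m t)) }) ,
  (λ k → subst (NumberOf _) (trans (Σ-length-trees≡C*motzkin m k) (sym (binom*motzkinℤ≡C*motzkin m k)))
                            (trees-NumberOf-young 1≤n k))
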